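{- Let $A$ be a divided complex and let $T$ be an additive set of faces of $A$. Let $x\subseteq\mathrm{Vr}(A)$ and $X\subseteq T$. Then $x\cup X$ is a face of $TA$ if and only if: (a) $t\not\subseteq x$ for each $t\in T$; (b) $x\cup\bigcup X$ is a face of $A$; (c) $X$ is linearly ordered by $\subseteq$; (d) for each $s\in X$ and $t\in T$, if $t\subseteq x\cup s$ then $t\subseteq s$.
   Context: $\mathrm{Ur}$ is a set of urelements. $\mathrm{Fin}^+_0=\mathrm{Ur}$, $\mathrm{Fin}^+_n=\{x:x\text{ finite},\ \emptyset\ne x\subseteq\mathrm{Fin}^+_{n-1}\}$, $\mathrm{Fin}^+=\bigcup_{n\ge1}\mathrm{Fin}^+_n$. A complex is a family $A$ of nonempty finite sets closed under nonempty subsets with $\mathrm{Vr}(A)\cap A=\emptyset$, $\mathrm{Vr}(A)=\bigcup A$. For $A\subseteq\mathrm{Fin}^+$ and $s\in\mathrm{Fin}^+$, $sA=\{y\cup\{s\}: s\not\subseteq y,\ s\cup y\in A\}\cup\{y: s\not\subseteq y,\ y\in A\}$; $s_0\cdots s_lA=s_0(s_1(\cdots(s_lA)\cdots))$. A complex is grounded if all its faces are subsets of $\mathrm{Ur}$, and divided if it equals $s_0\cdots s_lG$ for a grounded complex $G$ and $s_i\in\mathrm{Fin}^+$. A family $T\subseteq A$ is additive if $t_1\cup t_2\in T$ whenever $t_1,t_2\in T$ and $t_1\cup t_2\in A$; $TA:=t_0\cdots t_nA$ where $t_0,\dots,t_n$ lists $T$ injectively with $t_i\subseteq t_j\Rightarrow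 i\le j$ (this does not depend on the listing). -}

module Defs where

open import Data.List using (List; []; _∷_; _++_; concatMap)
open import Data.List.Relation.Unary.AllPairs using (AllPairs)
open import Data.List.Relation.Unary.All using (All)
open import Data.Product using (Σ; _×_; _,_)
open import Data.Sum using (_⊎_)
open import Data.Empty using (⊥)
open import Data.Unit using (⊤)
open import Relation.Nullary using (¬_)
open import Relation.Binary.PropositionalEquality using (_≡_)

-- Hereditarily finite sets over a type U of urelements.
-- `ur a` is the urelement a, `node xs` is the finite set with the
-- elements listed in xs (order and repetitions irrelevant: equality of
-- sets is the extensional equality _≈_ below).

data HF (U : Set) : Set where
  ur   : U → HF U
  node : List (HF U) → HF U

infix 4 _≈_ _∈ₗ_ _⊆ₗ_ _∈_ _⊆_

mutual
  _≈_ : {U : Set} → HF U → HF U → Set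
  ur a    ≈ ur b    = a ≡ b
  ur _    ≈ node _  = ⊥
  node _  ≈ ur _    = ⊥
  node xs ≈ node ys = (xs ⊆ₗ ys) × (ys ⊆ₗ xs)

  _∈ₗ_ : {U : Set} → HF U → List (HF U) → Set
  x ∈ₗ []       = ⊥
  x ∈ₗ (y ∷ ys) = (x ≈ y) ⊎ (x ∈ₗ ys)

  _⊆ₗ_ : {U : Set} → List (HF U) → List (HF U) → Set
  []       ⊆ₗ ys = ⊤
  (x ∷ xs) ⊆ₗ ys = (x ∈ₗ ys) × (xs ⊆ₗ ys)

_∈_ : {U : Set} → HF U → HF U → Set
x ∈ ur _    = ⊥
x ∈ node ys = x ∈ₗ ys

_⊆_ : {U : Set} → HF U → HF U → Set
a ⊆ b = ∀ v → v ∈ a → v ∈ b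

IsSet : {U : Set} → HF U → Set
IsSet (ur _)   = ⊥
IsSet (node _) = ⊤

NonEmpty : {U : Set} → HF U → Set
NonEmpty {U} a = Σ (HF U) λ v → v ∈ a

elems : {U : Set} → HF U → List (HF U)
elems (ur _)    = []
elems (node xs) = xs

infixl 6 _∪_
_∪_ : {U : Set} → HF U → HF U → HF U
a ∪ b = node (elems a ++ elems b)

⋃ : {U : Set} → List (HF U) → HF U
⋃ X = node (concatMap elems X)

mutual
  IsFin⁺ : {U : Set} → HF U → Set
  IsFin⁺ (ur _)          = ⊥
  IsFin⁺ (node [])       = ⊥
  IsFin⁺ (node (x ∷ xs)) = ElemsOK (x ∷ xs)

  ElemsOK : {U : Set} → List (HF U) → Set
  ElemsOK []       = ⊤
  ElemsOK (x ∷ xs) = ElemOK x × ElemsOK xs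

  ElemOK : {U : Set} → HF U → Set
  ElemOK (ur _)    = ⊤
  ElemOK (node ys) = IsFin⁺ (node ys)

Fam : Set → Set₁
Fam U = HF U → Set

Vr : {U : Set} → Fam U → Fam U
Vr {U} A v = Σ (HF U) λ f → A f × (v ∈ f)

record IsComplex {U : Set} (A : Fam U) : Set₁ where
  field
    face-set      : ∀ f → A f → IsSet f
    face-nonempty : ∀ f → A f → NonEmpty f
    down-closed   : ∀ f g → A f → IsSet g → NonEmpty g → g ⊆ f → A g
    vr-disjoint   : ∀ v → Vr A v → ¬ A v

IsGrounded : {U : Set} → Fam U → Set
IsGrounded {U} A = ∀ f → A f → ∀ v → v ∈ f → Σ U λ a → v ≈ ur a

subdiv : {U : Set} → HF U → Fam U → Fam U
subdiv {U} s A z =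
    (Σ (List (HF U)) λ y → ¬ (s ⊆ node y) × A (s ∪ node y) × (z ≈ node (s ∷ y)))
  ⊎ (¬ (s ⊆ z) × A z)

subdivs : {U : Set} → List (HF U) → Fam U → Fam U
subdivs []       A = A
subdivs (s ∷ ss) A = subdiv s (subdivs ss A)

SameFam : {U : Set} → Fam U → Fam U → Set
SameFam {U} A B = ∀ (f : HF U) → (A f → B f) × (B f → A f)

IsDivided : {U : Set} → Fam U → Set₁
IsDivided {U} A =
  IsComplex A ×
  Σ (Fam U) λ G → IsComplex G × IsGrounded G ×
    Σ (List (HF U)) λ ss → All IsFin⁺ ss × SameFam A (subdivs ss G)

-- A finite family T ⊆ A given by a list ts (its members up to ≈).

Additive : {U : Set} → Fam U → List (HF U) → Set
Additive A ts = ∀ t₁ t₂ → t₁ ∈ₗ ts → t₂ ∈ₗ ts → A (t₁ ∪ t₂) → (t₁ ∪ t₂) ∈ₗ ts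

-- ts = t₀,…,tₙ lists T injectively with tᵢ ⊆ tⱼ ⇒ i ≤ j
-- (for positions i < j: tᵢ ≉ tⱼ and ¬ tⱼ ⊆ tᵢ)
AdmissibleListing : {U : Set} → List (HF U) → Set
AdmissibleListing ts = AllPairs (λ a b → ¬ (a ≈ b)) ts × AllPairs (λ a b → ¬ (b ⊆ a)) ts

applyT : {U : Set} → List (HF U) → Fam U → Fam U
applyT = subdivs

{-# OPTIONS --safe #-}

-- Induction on the listing t ∷ ts of T, so that TA = t B with B = ts A; admissibility
-- makes t minimal in T.  A face of t B is either {t} ∪ y with t ∪ y ∈ B and t ⊈ y, or a
-- face z of B with t ⊈ z.  Being a face of A, t is neither a vertex of A nor a member
-- of ts, so x ∪ X has the first form exactly when t ∈ X, and then y = x ∪ X′ with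
-- X′ = X ∖ {t}.  The induction hypothesis for B, applied to (t ∪ x, X′) or to (x, X),
-- then yields conditions (a)–(d) for T once we know that t ⊆ s for the relevant s ∈ ts:
-- t ∪ s lies in a face, so it is a face, hence in T by additivity and, by minimality of
-- t, in ts; condition (d) for ts now gives t ∪ s ⊆ s.

module Submission where

open import Defs
open import Data.List using (List; []; _∷_; _++_; [_])
open import Data.List.Properties using (++-assoc)
open import Data.List.Relation.Unary.All using (All; _∷_)
import Data.List.Relation.Unary.AllPairs as AllPairs
open import Data.Product using (Σ; _×_; _,_; proj₁; proj₂)
open import Data.Sum using (_⊎_; inj₁; inj₂; [_,_]′)
import Data.Sum as Sum
open import Data.Empty using (⊥-elim)
open import Data.Unit using (tt)
open import Function using (_∘_; case_of_)
open import Function.Bundles using (_⇔_; mk⇔; Equivalence)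
open import Relation.Binary.Bundles using (Setoid)
open import Relation.Binary.Definitions using (_Respects_)
open import Relation.Binary.PropositionalEquality using (refl; sym; trans)
open import Relation.Nullary using (¬_)
import Relation.Binary.Reasoning.Setoid as SetoidReasoning

private variable
  U : Set
  a b c s v w : HF U
  xs ys zs : List (HF U)

-- Hereditarily finite sets up to extensionality

⊆ₗ-∷ʳ : xs ⊆ₗ ys → xs ⊆ₗ v ∷ ys
⊆ₗ-∷ʳ {xs = []}    _        = tt
⊆ₗ-∷ʳ {xs = _ ∷ _} (p , ps) = inj₂ p , ⊆ₗ-∷ʳ ps

mutual
  ≈-refl : v ≈ v
  ≈-refl {v = ur _}   = refl
  ≈-refl {v = node _} = ⊆ₗ-refl , ⊆ₗ-refl

  ⊆ₗ-refl : xs ⊆ₗ xs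
  ⊆ₗ-refl {xs = []}    = tt
  ⊆ₗ-refl {xs = _ ∷ _} = inj₁ ≈-refl , ⊆ₗ-∷ʳ ⊆ₗ-refl

≈-sym : v ≈ w → w ≈ v
≈-sym {v = ur _}   {w = ur _}   p       = sym p
≈-sym {v = node _} {w = node _} (p , q) = q , p

mutual
  ≈-trans : a ≈ b → b ≈ c → a ≈ c
  ≈-trans {a = ur _}   {b = ur _}   {c = ur _}   p        q        = trans p q
  ≈-trans {a = node _} {b = node _} {c = node _} (p , p′) (q , q′) = ⊆ₗ-trans p q , ⊆ₗ-trans q′ p′

  ⊆ₗ-trans : xs ⊆ₗ ys → ys ⊆ₗ zs → xs ⊆ₗ zs
  ⊆ₗ-trans {xs = []}    _        _ = tt
  ⊆ₗ-trans {xs = _ ∷ _} (p , ps) q = ∈ₗ-⊆ₗ p q , ⊆ₗ-trans ps q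

  ∈ₗ-⊆ₗ : v ∈ₗ xs → xs ⊆ₗ ys → v ∈ₗ ys
  ∈ₗ-⊆ₗ {xs = _ ∷ _} (inj₁ v≈x) (x∈ys , _) = ∈ₗ-resp-≈ v≈x x∈ys
  ∈ₗ-⊆ₗ {xs = _ ∷ _} (inj₂ v∈xs) (_ , xs⊆ys) = ∈ₗ-⊆ₗ v∈xs xs⊆ys

  ∈ₗ-resp-≈ : v ≈ w → w ∈ₗ xs → v ∈ₗ xs
  ∈ₗ-resp-≈ {xs = _ ∷ _} v≈w (inj₁ w≈x)  = inj₁ (≈-trans v≈w w≈x)
  ∈ₗ-resp-≈ {xs = _ ∷ _} v≈w (inj₂ w∈xs) = inj₂ (∈ₗ-resp-≈ v≈w w∈xs)

≈-setoid : Set → Setoid _ _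
≈-setoid U = record
  { Carrier       = HF U
  ; _≈_           = _≈_
  ; isEquivalence = record { refl = ≈-refl ; sym = ≈-sym ; trans = ≈-trans }
  }

∈-resp-≈ : v ≈ w → w ∈ a → v ∈ a
∈-resp-≈ {a = node _} = ∈ₗ-resp-≈

∈ₗ-++⁺ˡ : v ∈ₗ xs → v ∈ₗ xs ++ ys
∈ₗ-++⁺ˡ {xs = _ ∷ _} (inj₁ v≈x)  = inj₁ v≈x
∈ₗ-++⁺ˡ {xs = _ ∷ _} (inj₂ v∈xs) = inj₂ (∈ₗ-++⁺ˡ v∈xs)

∈ₗ-++⁺ʳ : (xs : List (HF U)) → v ∈ₗ ys → v ∈ₗ xs ++ ys
∈ₗ-++⁺ʳ []       v∈ys = v∈ys
∈ₗ-++⁺ʳ (_ ∷ xs) v∈ys = inj₂ (∈ₗ-++⁺ʳ xs v∈ys)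

∈ₗ-++⁻ : (xs : List (HF U)) → v ∈ₗ xs ++ ys → v ∈ₗ xs ⊎ v ∈ₗ ys
∈ₗ-++⁻ []       v∈ys          = inj₂ v∈ys
∈ₗ-++⁻ (_ ∷ _)  (inj₁ v≈x)    = inj₁ (inj₁ v≈x)
∈ₗ-++⁻ (_ ∷ xs) (inj₂ v∈xs++) = Sum.map₁ inj₂ (∈ₗ-++⁻ xs v∈xs++)

∈⇒∈ₗ-elems : v ∈ a → v ∈ₗ elems a
∈⇒∈ₗ-elems {a = node _} v∈a = v∈a

∈ₗ-elems⇒∈ : v ∈ₗ elems a → v ∈ a
∈ₗ-elems⇒∈ {a = node _} v∈a = v∈a

-- _⊆_ unfolds to a function type from which Agda cannot recover the two sets; the record
-- wrapper makes them inferable.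
infix 4 _⊑_

record _⊑_ {U : Set} (a b : HF U) : Set where
  constructor ⊆⇒⊑
  field ⊑⇒⊆ : a ⊆ b

open _⊑_ public

∈-⊑ : v ∈ a → a ⊑ b → v ∈ b
∈-⊑ v∈a a⊑b = ⊑⇒⊆ a⊑b _ v∈a

⊑-trans : a ⊑ b → b ⊑ c → a ⊑ c
⊑-trans a⊑b b⊑c = ⊆⇒⊑ λ _ v∈a → ∈-⊑ (∈-⊑ v∈a a⊑b) b⊑c

⊆-⊑-trans : (a : HF U) → a ⊆ b → b ⊑ c → a ⊆ c
⊆-⊑-trans _ a⊆b b⊑c v v∈a = ∈-⊑ (a⊆b v v∈a) b⊑c

≈⇒⊑ : a ≈ b → a ⊑ b
≈⇒⊑ {a = ur _}   {b = ur _}   _        = ⊆⇒⊑ λ _ ()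
≈⇒⊑ {a = node _} {b = node _} (xs⊆ys , _) = ⊆⇒⊑ λ _ v∈xs → ∈ₗ-⊆ₗ v∈xs xs⊆ys

⊑⇒⊆ₗ : node xs ⊑ node ys → xs ⊆ₗ ys
⊑⇒⊆ₗ {xs = []}    _  = tt
⊑⇒⊆ₗ {xs = _ ∷ _} xs⊑ys =
  ∈-⊑ (inj₁ ≈-refl) xs⊑ys , ⊑⇒⊆ₗ (⊆⇒⊑ λ _ v∈xs → ∈-⊑ (inj₂ v∈xs) xs⊑ys)

⊑-antisym : node xs ⊑ node ys → node ys ⊑ node xs → node xs ≈ node ys
⊑-antisym xs⊑ys ys⊑xs = ⊑⇒⊆ₗ xs⊑ys , ⊑⇒⊆ₗ ys⊑xs

⊑-∪ˡ : (a b : HF U) → a ⊑ a ∪ b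
⊑-∪ˡ a _ = ⊆⇒⊑ λ _ v∈a → ∈ₗ-++⁺ˡ (∈⇒∈ₗ-elems {a = a} v∈a)

⊑-∪ʳ : (a b : HF U) → b ⊑ a ∪ b
⊑-∪ʳ a b = ⊆⇒⊑ λ _ v∈b → ∈ₗ-++⁺ʳ (elems a) (∈⇒∈ₗ-elems {a = b} v∈b)

∈-∪⁻ : (a b : HF U) → v ∈ a ∪ b → v ∈ a ⊎ v ∈ b
∈-∪⁻ a b v∈a∪b = Sum.map (∈ₗ-elems⇒∈ {a = a}) (∈ₗ-elems⇒∈ {a = b}) (∈ₗ-++⁻ (elems a) v∈a∪b)

∪-⊑ : a ⊑ c → b ⊑ c → a ∪ b ⊑ c
∪-⊑ {a = a} {b = b} a⊑c b⊑c =
  ⊆⇒⊑ λ _ v∈a∪b → [ (λ v∈a → ∈-⊑ v∈a a⊑c) , (λ v∈b → ∈-⊑ v∈b b⊑c) ]′ (∈-∪⁻ a b v∈a∪b)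

∪-monoʳ : (a : HF U) → b ⊑ c → a ∪ b ⊑ a ∪ c
∪-monoʳ {c = c} a b⊑c = ∪-⊑ (⊑-∪ˡ a c) (⊑-trans b⊑c (⊑-∪ʳ a c))

∪-comm-⊑ : (a b : HF U) → a ∪ b ⊑ b ∪ a
∪-comm-⊑ a b = ∪-⊑ (⊑-∪ʳ b a) (⊑-∪ˡ b a)

∪-monoˡ : (c : HF U) → a ⊑ b → a ∪ c ⊑ b ∪ c
∪-monoˡ {b = b} c a⊑b = ∪-⊑ (⊑-trans a⊑b (⊑-∪ˡ b c)) (⊑-∪ʳ b c)

∪-congʳ : (a : HF U) → b ≈ c → a ∪ b ≈ a ∪ c
∪-congʳ a b≈c = ⊑-antisym (∪-monoʳ a (≈⇒⊑ b≈c)) (∪-monoʳ a (≈⇒⊑ (≈-sym b≈c)))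

∪-assoc : (a b c : HF U) → (a ∪ b) ∪ c ≈ a ∪ (b ∪ c)
∪-assoc a b c rewrite ++-assoc (elems a) (elems b) (elems c) = ≈-refl

∪-swap : (a b c : HF U) → a ∪ (b ∪ c) ≈ b ∪ (a ∪ c)
∪-swap a b c = ⊑-antisym (swap a b c) (swap b a c)
  where
  swap : (a b c : HF U) → a ∪ (b ∪ c) ⊑ b ∪ (a ∪ c)
  swap a b c = ∪-⊑ (⊑-trans (⊑-∪ˡ a c) (⊑-∪ʳ b (a ∪ c))) (∪-monoʳ b (⊑-∪ʳ a c))

⊑-⋃ : (X : List (HF U)) → a ∈ₗ X → a ⊑ ⋃ X
⊑-⋃ (b ∷ X) (inj₁ a≈b) = ⊑-trans (≈⇒⊑ a≈b) (⊑-∪ˡ b (⋃ X))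
⊑-⋃ (b ∷ X) (inj₂ a∈X) = ⊑-trans (⊑-⋃ X a∈X) (⊑-∪ʳ b (⋃ X))

⋃-⊑ : (X : List (HF U)) → (∀ s → s ∈ₗ X → s ⊑ c) → ⋃ X ⊑ c
⋃-⊑ []      _   = ⊆⇒⊑ λ _ ()
⋃-⊑ (b ∷ X) X⊑c = ∪-⊑ (X⊑c b (inj₁ ≈-refl)) (⋃-⊑ X λ s s∈X → X⊑c s (inj₂ s∈X))

⋃-cong : (X Y : List (HF U)) → node X ≈ node Y → ⋃ X ≈ ⋃ Y
⋃-cong X Y X≈Y = ⊑-antisym (⋃-mono X Y (≈⇒⊑ X≈Y)) (⋃-mono Y X (≈⇒⊑ (≈-sym X≈Y)))
  where
  ⋃-mono : (X Y : List (HF U)) → node X ⊑ node Y → ⋃ X ⊑ ⋃ Y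
  ⋃-mono X Y X⊑Y = ⋃-⊑ X λ s s∈X → ⊑-⋃ Y (∈-⊑ s∈X X⊑Y)

∷-cancel : ¬ a ∈ₗ xs → ¬ a ∈ₗ ys → node (a ∷ xs) ≈ node (a ∷ ys) → node xs ≈ node ys
∷-cancel a∉xs a∉ys a∷xs≈a∷ys =
  ⊑-antisym (cancel a∉xs (≈⇒⊑ a∷xs≈a∷ys)) (cancel a∉ys (≈⇒⊑ (≈-sym a∷xs≈a∷ys)))
  where
  cancel : ¬ a ∈ₗ xs → node (a ∷ xs) ⊑ node (a ∷ ys) → node xs ⊑ node ys
  cancel a∉xs a∷xs⊑a∷ys = ⊆⇒⊑ λ _ v∈xs → case ∈-⊑ (inj₂ v∈xs) a∷xs⊑a∷ys of λ where
    (inj₁ v≈a)  → ⊥-elim (a∉xs (∈ₗ-resp-≈ (≈-sym v≈a) v∈xs))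
    (inj₂ v∈ys) → v∈ys

singleton-⊑ : v ∈ a → node [ v ] ⊑ a
singleton-⊑ {a = a} v∈a = ⊆⇒⊑ λ where _ (inj₁ w≈v) → ∈-resp-≈ {a = a} w≈v v∈a

lookup-≈ : {P : HF U → Set} → All P xs → v ∈ₗ xs → Σ (HF U) λ w → v ≈ w × P w
lookup-≈ (Pw ∷ _)  (inj₁ v≈w)  = _ , v≈w , Pw
lookup-≈ (_  ∷ Ps) (inj₂ v∈xs) = lookup-≈ Ps v∈xs

-- Complexes and stellar subdivisions

module _ {A : Fam U} (C : IsComplex A) where
  open IsComplex C

  face-⊑ : A a → b ⊑ a → IsSet b → NonEmpty b → A b
  face-⊑ Aa b⊑a b-set b-nonempty = down-closed _ _ Aa b-set b-nonempty (⊑⇒⊆ b⊑a)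

  face-≈ : a ≈ b → A a → A b
  face-≈ {a = ur _} _ Aa = ⊥-elim (face-set _ Aa)
  face-≈ {a = node _} {b = node _} a≈b Aa with face-nonempty _ Aa
  ... | v , v∈a = face-⊑ Aa (≈⇒⊑ (≈-sym a≈b)) tt (v , ∈-⊑ v∈a (≈⇒⊑ a≈b))

  ∪-face : (b : HF U) → A a → A c → a ∪ b ⊑ c → A (a ∪ b)
  ∪-face {a = a} b Aa Ac a∪b⊑c with face-nonempty _ Aa
  ... | v , v∈a = face-⊑ Ac a∪b⊑c tt (v , ∈-⊑ v∈a (⊑-∪ˡ a b))

subdiv-resp-≈ : (s : HF U) {A : Fam U} → A Respects _≈_ → subdiv s A Respects _≈_
subdiv-resp-≈ s _ a≈b (inj₁ (y , s⊈y , A[s∪y] , a≈s∷y)) =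
  inj₁ (y , s⊈y , A[s∪y] , ≈-trans (≈-sym a≈b) a≈s∷y)
subdiv-resp-≈ s A-resp {y = b} a≈b (inj₂ (s⊈a , Aa)) = inj₂ (s⊈b , A-resp a≈b Aa)
  where
  s⊈b : ¬ s ⊆ b
  s⊈b s⊆b = s⊈a λ v v∈s → ∈-⊑ (s⊆b v v∈s) (≈⇒⊑ (≈-sym a≈b))

subdivs-resp-≈ : (ss : List (HF U)) {A : Fam U} → A Respects _≈_ → subdivs ss A Respects _≈_
subdivs-resp-≈ []       A-resp = A-resp
subdivs-resp-≈ (s ∷ ss) A-resp = subdiv-resp-≈ s (subdivs-resp-≈ ss A-resp)

subdivs-element : (ss : List (HF U)) {A : Fam U} → subdivs ss A a → v ∈ a → Vr A v ⊎ v ∈ₗ ss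
subdivs-element []       Aa v∈a = inj₁ (_ , Aa , v∈a)
subdivs-element (s ∷ ss) (inj₁ (y , _ , A[s∪y] , a≈s∷y)) v∈a with ∈-⊑ v∈a (≈⇒⊑ a≈s∷y)
... | inj₁ v≈s = inj₂ (inj₁ v≈s)
... | inj₂ v∈y = Sum.map₂ inj₂ (subdivs-element ss A[s∪y] (∈-⊑ v∈y (⊑-∪ʳ s (node y))))
subdivs-element (s ∷ ss) (inj₂ (_ , Aa)) v∈a = Sum.map₂ inj₂ (subdivs-element ss Aa v∈a)

-- Faces of TA

Avoids : List (HF U) → HF U → Set
Avoids ts a = ∀ t → t ∈ₗ ts → ¬ (t ⊆ a)

IsChain : List (HF U) → Set
IsChain X = ∀ s s′ → s ∈ₗ X → s′ ∈ₗ X → (s ⊆ s′) ⊎ (s′ ⊆ s)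

AvoidsBeyond : (ts x X : List (HF U)) → Set
AvoidsBeyond ts x X = ∀ s t → s ∈ₗ X → t ∈ₗ ts → t ⊆ (node x ∪ s) → t ⊆ s

FaceConditions : Fam U → (ts x X : List (HF U)) → Set
FaceConditions A ts x X = Avoids ts (node x) × A (node x ∪ ⋃ X) × IsChain X × AvoidsBeyond ts x X

FaceCharacterisation : Fam U → List (HF U) → Set
FaceCharacterisation {U} A ts =
  (x X : List (HF U)) → (∀ v → v ∈ₗ x → Vr A v) → (∀ s → s ∈ₗ X → s ∈ₗ ts) →
  applyT ts A (node (x ++ X)) ⇔ FaceConditions A ts x X

record AdditiveListing (A : Fam U) (ts : List (HF U)) : Set where
  field
    faces      : ∀ t → t ∈ₗ ts → A t
    additive   : Additive A ts
    admissible : AdmissibleListing ts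

module Step {U : Set} {A : Fam U} (C : IsComplex A) {t : HF U} {ts : List (HF U)}
            (T : AdditiveListing A (t ∷ ts)) where
  open IsComplex C
  open AdditiveListing T

  B : Fam U
  B = applyT ts A

  head-face : A t
  head-face = faces t (inj₁ ≈-refl)

  tail-face : v ∈ₗ ts → A v
  tail-face v∈ts = faces _ (inj₂ v∈ts)

  tail-⋢-head : v ∈ₗ ts → ¬ v ⊑ t
  tail-⋢-head v∈ts v⊑t with lookup-≈ (AllPairs.head (proj₂ admissible)) v∈ts
  ... | w , v≈w , w⊈t = w⊈t (⊑⇒⊆ (⊑-trans (≈⇒⊑ (≈-sym v≈w)) v⊑t))

  head-∉-tail : ¬ t ∈ₗ ts
  head-∉-tail t∈ts with lookup-≈ (AllPairs.head (proj₁ admissible)) t∈ts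
  ... | _ , t≈w , t≉w = t≉w t≈w

  head-vertex : v ∈ t → Vr A v
  head-vertex v∈t = t , head-face , v∈t

  head-not-vertex : ¬ Vr A t
  head-not-vertex t-vertex = vr-disjoint t t-vertex head-face

  vertex-∉-tail : Vr A v → ¬ v ∈ₗ ts
  vertex-∉-tail v-vertex v∈ts = vr-disjoint _ v-vertex (tail-face v∈ts)

  head-∉-B : B a → ¬ t ∈ a
  head-∉-B Ba t∈a = [ head-not-vertex , head-∉-tail ]′ (subdivs-element ts Ba t∈a)

  B-≈ : a ≈ b → B a → B b
  B-≈ = subdivs-resp-≈ ts (face-≈ C)

  ∪-head-∈-tail : v ∈ₗ ts → A (t ∪ v) → t ∪ v ∈ₗ ts
  ∪-head-∈-tail {v = v} v∈ts A[t∪v] with additive t v (inj₁ ≈-refl) (inj₂ v∈ts) A[t∪v]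
  ... | inj₁ t∪v≈t  = ⊥-elim (tail-⋢-head v∈ts (⊑-trans (⊑-∪ʳ t v) (≈⇒⊑ t∪v≈t)))
  ... | inj₂ t∪v∈ts = t∪v∈ts

  listing-tail : AdditiveListing A ts
  listing-tail = record
    { faces      = λ _ → tail-face
    ; additive   = additive-tail
    ; admissible = AllPairs.tail (proj₁ admissible) , AllPairs.tail (proj₂ admissible)
    }
    where
    additive-tail : Additive A ts
    additive-tail u w u∈ts w∈ts A[u∪w] with additive u w (inj₂ u∈ts) (inj₂ w∈ts) A[u∪w]
    ... | inj₁ u∪w≈t  = ⊥-elim (tail-⋢-head u∈ts (⊑-trans (⊑-∪ˡ u w) (≈⇒⊑ u∪w≈t)))
    ... | inj₂ u∪w∈ts = u∪w∈ts

  ∪-head-vertices : (x : List (HF U)) → (∀ v → v ∈ₗ x → Vr A v) → ∀ v → v ∈ₗ elems t ++ x → Vr A v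
  ∪-head-vertices x x-vertices v v∈t∪x = [ head-vertex , x-vertices v ]′ (∈-∪⁻ t (node x) v∈t∪x)

  head-∉ : (x X : List (HF U)) → (∀ v → v ∈ₗ x → Vr A v) → node X ⊑ node ts → ¬ t ∈ₗ x ++ X
  head-∉ x X x-vertices X⊑ts t∈x++X with ∈-∪⁻ (node x) (node X) t∈x++X
  ... | inj₁ t∈x = head-not-vertex (x-vertices t t∈x)
  ... | inj₂ t∈X = head-∉-tail (∈-⊑ t∈X X⊑ts)

  head-⋢ : (x X : List (HF U)) → Avoids (t ∷ ts) (node x) → node X ⊑ node ts → ¬ t ⊑ node x ∪ node X
  head-⋢ x X avoids X⊑ts t⊑x∪X = avoids t (inj₁ ≈-refl) λ v v∈t →
    case ∈-∪⁻ (node x) (node X) (∈-⊑ v∈t t⊑x∪X) of λ where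
      (inj₁ v∈x) → v∈x
      (inj₂ v∈X) → ⊥-elim (vertex-∉-tail (head-vertex v∈t) (∈-⊑ v∈X X⊑ts))

  avoidsBeyond-head : (x X : List (HF U)) → A (node x ∪ ⋃ X) → AvoidsBeyond ts x X →
                      s ∈ₗ X → s ∈ₗ ts → t ⊑ node x ∪ s → t ⊑ s
  avoidsBeyond-head {s = s} x X face beyond s∈X s∈ts t⊑x∪s =
    ⊑-trans (⊑-∪ˡ t s) (⊆⇒⊑ (beyond s (t ∪ s) s∈X t∪s∈ts (⊑⇒⊆ t∪s⊑x∪s)))
    where
    t∪s⊑x∪s : t ∪ s ⊑ node x ∪ s
    t∪s⊑x∪s = ∪-⊑ t⊑x∪s (⊑-∪ʳ (node x) s)
    t∪s∈ts : t ∪ s ∈ₗ ts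
    t∪s∈ts = ∪-head-∈-tail s∈ts
      (∪-face C s head-face face (⊑-trans t∪s⊑x∪s (∪-monoʳ (node x) (⊑-⋃ X s∈X))))

  conditions-tail : (x X : List (HF U)) → FaceConditions A (t ∷ ts) x X → FaceConditions A ts x X
  conditions-tail x X (avoids , face , chain , beyond) =
    (λ u → avoids u ∘ inj₂) , face , chain , λ s u s∈X → beyond s u s∈X ∘ inj₂

  conditions-∷ : (x X : List (HF U)) → ¬ t ⊑ node x → node X ⊑ node ts →
                 FaceConditions A ts x X → FaceConditions A (t ∷ ts) x X
  conditions-∷ x X t⋢x X⊑ts (avoids , face , chain , beyond) = avoids′ , face , chain , beyond′
    where
    avoids′ : Avoids (t ∷ ts) (node x)
    avoids′ u (inj₁ u≈t)  u⊆x = t⋢x (⊑-trans (≈⇒⊑ (≈-sym u≈t)) (⊆⇒⊑ u⊆x))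
    avoids′ u (inj₂ u∈ts)     = avoids u u∈ts
    beyond′ : AvoidsBeyond (t ∷ ts) x X
    beyond′ s u s∈X (inj₁ u≈t)  u⊆x∪s = ⊑⇒⊆ (⊑-trans (≈⇒⊑ u≈t) t⊑s)
      where
      t⊑s : t ⊑ s
      t⊑s = avoidsBeyond-head x X face beyond s∈X (∈-⊑ s∈X X⊑ts)
              (⊑-trans (≈⇒⊑ (≈-sym u≈t)) (⊆⇒⊑ u⊆x∪s))
    beyond′ s u s∈X (inj₂ u∈ts) = beyond s u s∈X u∈ts

  data Split (X : List (HF U)) : Set where
    tail-only : node X ⊑ node ts → Split X
    with-head : (X′ : List (HF U)) → node X′ ⊑ node ts → node X ≈ node (t ∷ X′) → Split X

  split : (X : List (HF U)) → node X ⊑ node (t ∷ ts) → Split X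
  split []      _        = tail-only (⊆⇒⊑ λ _ ())
  split (s ∷ X) s∷X⊑t∷ts
    with ∈-⊑ (inj₁ ≈-refl) s∷X⊑t∷ts | split X (⊑-trans (⊑-∪ʳ (node [ s ]) (node X)) s∷X⊑t∷ts)
  ... | inj₁ s≈t  | tail-only X⊑ts =
    with-head X X⊑ts (⊑-antisym (∪-⊑ (singleton-⊑ (inj₁ s≈t)) (⊑-∪ʳ (node [ t ]) (node X)))
                                (∪-⊑ (singleton-⊑ (inj₁ (≈-sym s≈t))) (⊑-∪ʳ (node [ s ]) (node X))))
  ... | inj₁ s≈t  | with-head X′ X′⊑ts X≈t∷X′ =
    with-head X′ X′⊑ts (⊑-antisym (∪-⊑ (singleton-⊑ (inj₁ s≈t)) (≈⇒⊑ X≈t∷X′))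
                                  (⊑-trans (≈⇒⊑ (≈-sym X≈t∷X′)) (⊑-∪ʳ (node [ s ]) (node X))))
  ... | inj₂ s∈ts | tail-only X⊑ts = tail-only (∪-⊑ (singleton-⊑ s∈ts) X⊑ts)
  ... | inj₂ s∈ts | with-head X′ X′⊑ts X≈t∷X′ =
    with-head (s ∷ X′) (∪-⊑ (singleton-⊑ s∈ts) X′⊑ts)
      (≈-trans (∪-congʳ (node [ s ]) X≈t∷X′) (∪-swap (node [ s ]) (node [ t ]) (node X′)))

  module WithHead (x X X′ : List (HF U)) (X′⊑ts : node X′ ⊑ node ts)
                  (X≈t∷X′ : node X ≈ node (t ∷ X′)) where
    open SetoidReasoning (≈-setoid U)

    head-∈ : t ∈ₗ X
    head-∈ = ∈-⊑ (inj₁ ≈-refl) (≈⇒⊑ (≈-sym X≈t∷X′))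

    X′⊑X : node X′ ⊑ node X
    X′⊑X = ⊑-trans (⊑-∪ʳ (node [ t ]) (node X′)) (≈⇒⊑ (≈-sym X≈t∷X′))

    X⊑t∷X′ : node X ⊑ node (t ∷ X′)
    X⊑t∷X′ = ≈⇒⊑ X≈t∷X′

    x++X≈t∷x++X′ : node (x ++ X) ≈ node (t ∷ x ++ X′)
    x++X≈t∷x++X′ = begin
      node x ∪ node X                   ≈⟨ ∪-congʳ (node x) X≈t∷X′ ⟩
      node x ∪ (node [ t ] ∪ node X′)   ≈⟨ ∪-swap (node x) (node [ t ]) (node X′) ⟩
      node [ t ] ∪ (node x ∪ node X′)   ∎

    x∪⋃X≈t∪x∪⋃X′ : node x ∪ ⋃ X ≈ (t ∪ node x) ∪ ⋃ X′
    x∪⋃X≈t∪x∪⋃X′ = begin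
      node x ∪ ⋃ X           ≈⟨ ∪-congʳ (node x) (⋃-cong X (t ∷ X′) X≈t∷X′) ⟩
      node x ∪ (t ∪ ⋃ X′)    ≈⟨ ∪-swap (node x) t (⋃ X′) ⟩
      t ∪ (node x ∪ ⋃ X′)    ≈⟨ ∪-assoc t (node x) (⋃ X′) ⟨
      (t ∪ node x) ∪ ⋃ X′    ∎

    conditions-merge-head : FaceConditions A (t ∷ ts) x X →
                            FaceConditions A ts (elems t ++ x) X′
    conditions-merge-head (avoids , face , chain , beyond) = avoids′ , face′ , chain′ , beyond′
      where
      head-⊑ : s ∈ₗ X′ → t ⊑ s
      head-⊑ {s = s} s∈X′ with chain t s head-∈ (∈-⊑ s∈X′ X′⊑X)
      ... | inj₁ t⊆s = ⊆⇒⊑ t⊆s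
      ... | inj₂ s⊆t = ⊥-elim (tail-⋢-head (∈-⊑ s∈X′ X′⊑ts) (⊆⇒⊑ s⊆t))
      avoids′ : Avoids ts (t ∪ node x)
      avoids′ u u∈ts u⊆t∪x =
        tail-⋢-head u∈ts
          (⊆⇒⊑ (beyond t u head-∈ (inj₂ u∈ts) (⊆-⊑-trans u u⊆t∪x (∪-comm-⊑ t (node x)))))
      face′ : A ((t ∪ node x) ∪ ⋃ X′)
      face′ = face-≈ C x∪⋃X≈t∪x∪⋃X′ face
      chain′ : IsChain X′
      chain′ s s′ s∈X′ s′∈X′ = chain s s′ (∈-⊑ s∈X′ X′⊑X) (∈-⊑ s′∈X′ X′⊑X)
      beyond′ : AvoidsBeyond ts (elems t ++ x) X′
      beyond′ s u s∈X′ u∈ts u⊆t∪x∪s =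
        beyond s u (∈-⊑ s∈X′ X′⊑X) (inj₂ u∈ts) (⊆-⊑-trans u u⊆t∪x∪s t∪x∪s⊑x∪s)
        where
        t∪x∪s⊑x∪s : (t ∪ node x) ∪ s ⊑ node x ∪ s
        t∪x∪s⊑x∪s = ∪-⊑ (∪-⊑ (⊑-trans (head-⊑ s∈X′) (⊑-∪ʳ (node x) s)) (⊑-∪ˡ (node x) s))
                        (⊑-∪ʳ (node x) s)

    conditions-split-head : ¬ t ⊑ node x → FaceConditions A ts (elems t ++ x) X′ →
                            FaceConditions A (t ∷ ts) x X
    conditions-split-head t⋢x (avoids , face , chain , beyond) = avoids′ , face′ , chain′ , beyond′
      where
      head-⊑ : s ∈ₗ X → t ⊑ s
      head-⊑ {s = s} s∈X with ∈-⊑ s∈X X⊑t∷X′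
      ... | inj₁ s≈t  = ≈⇒⊑ (≈-sym s≈t)
      ... | inj₂ s∈X′ = avoidsBeyond-head (elems t ++ x) X′ face beyond s∈X′ (∈-⊑ s∈X′ X′⊑ts)
                          (⊑-trans (⊑-∪ˡ t (node x)) (⊑-∪ˡ (t ∪ node x) s))
      avoids′ : Avoids (t ∷ ts) (node x)
      avoids′ u (inj₁ u≈t)  u⊆x = t⋢x (⊑-trans (≈⇒⊑ (≈-sym u≈t)) (⊆⇒⊑ u⊆x))
      avoids′ u (inj₂ u∈ts) u⊆x = avoids u u∈ts (⊆-⊑-trans u u⊆x (⊑-∪ʳ t (node x)))
      face′ : A (node x ∪ ⋃ X)
      face′ = face-≈ C (≈-sym x∪⋃X≈t∪x∪⋃X′) face
      chain′ : IsChain X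
      chain′ s s′ s∈X s′∈X with ∈-⊑ s∈X X⊑t∷X′ | ∈-⊑ s′∈X X⊑t∷X′
      ... | inj₁ s≈t  | _          = inj₁ (⊑⇒⊆ (⊑-trans (≈⇒⊑ s≈t) (head-⊑ s′∈X)))
      ... | inj₂ _    | inj₁ s′≈t  = inj₂ (⊑⇒⊆ (⊑-trans (≈⇒⊑ s′≈t) (head-⊑ s∈X)))
      ... | inj₂ s∈X′ | inj₂ s′∈X′ = chain s s′ s∈X′ s′∈X′
      beyond′ : AvoidsBeyond (t ∷ ts) x X
      beyond′ s u s∈X (inj₁ u≈t)  _ = ⊑⇒⊆ (⊑-trans (≈⇒⊑ u≈t) (head-⊑ s∈X))
      beyond′ s u s∈X (inj₂ u∈ts) u⊆x∪s with ∈-⊑ s∈X X⊑t∷X′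
      ... | inj₁ s≈t  = ⊥-elim (avoids u u∈ts (⊆-⊑-trans u u⊆x∪s x∪s⊑t∪x))
        where
        x∪s⊑t∪x : node x ∪ s ⊑ t ∪ node x
        x∪s⊑t∪x = ⊑-trans (∪-monoʳ (node x) (≈⇒⊑ s≈t)) (∪-comm-⊑ (node x) t)
      ... | inj₂ s∈X′ = beyond s u s∈X′ u∈ts (⊆-⊑-trans u u⊆x∪s (∪-monoˡ s (⊑-∪ʳ t (node x))))

    faces-with-head : FaceCharacterisation A ts → (∀ v → v ∈ₗ x → Vr A v) →
                      subdiv t B (node (x ++ X)) ⇔ FaceConditions A (t ∷ ts) x X
    faces-with-head IH x-vertices = mk⇔ to from
      where
      IH′ : B ((t ∪ node x) ∪ node X′) ⇔ FaceConditions A ts (elems t ++ x) X′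
      IH′ = IH (elems t ++ x) X′ (∪-head-vertices x x-vertices) (⊑⇒⊆ X′⊑ts)
      to : subdiv t B (node (x ++ X)) → FaceConditions A (t ∷ ts) x X
      to (inj₁ (y , t⊈y , B[t∪y] , x++X≈t∷y)) = conditions-split-head t⋢x (Equivalence.to IH′ B′)
        where
        t∉y : ¬ t ∈ₗ y
        t∉y t∈y = head-∉-B B[t∪y] (∈-⊑ t∈y (⊑-∪ʳ t (node y)))
        y≈x++X′ : node y ≈ node (x ++ X′)
        y≈x++X′ = ∷-cancel t∉y (head-∉ x X′ x-vertices X′⊑ts)
                    (≈-trans (≈-sym x++X≈t∷y) x++X≈t∷x++X′)
        t⋢x : ¬ t ⊑ node x
        t⋢x t⊑x =
          t⊈y (⊑⇒⊆ (⊑-trans t⊑x (⊑-trans (⊑-∪ˡ (node x) (node X′)) (≈⇒⊑ (≈-sym y≈x++X′)))))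
        B′ : B ((t ∪ node x) ∪ node X′)
        B′ = B-≈ (≈-trans (∪-congʳ t y≈x++X′) (≈-sym (∪-assoc t (node x) (node X′)))) B[t∪y]
      to (inj₂ (_ , B[x++X])) =
        ⊥-elim (head-∉-B B[x++X] (∈-⊑ (inj₁ ≈-refl) (≈⇒⊑ (≈-sym x++X≈t∷x++X′))))
      from : FaceConditions A (t ∷ ts) x X → subdiv t B (node (x ++ X))
      from conditions@(avoids , _) = inj₁ (x ++ X′ , t⊈x++X′ , B[t∪x++X′] , x++X≈t∷x++X′)
        where
        t⊈x++X′ : ¬ t ⊆ node (x ++ X′)
        t⊈x++X′ = head-⋢ x X′ avoids X′⊑ts ∘ ⊆⇒⊑
        B[t∪x++X′] : B (t ∪ node (x ++ X′))
        B[t∪x++X′] = B-≈ (∪-assoc t (node x) (node X′))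
                         (Equivalence.from IH′ (conditions-merge-head conditions))

  faces-tail-only : FaceCharacterisation A ts → (x X : List (HF U)) → (∀ v → v ∈ₗ x → Vr A v) →
                    node X ⊑ node ts → subdiv t B (node (x ++ X)) ⇔ FaceConditions A (t ∷ ts) x X
  faces-tail-only IH x X x-vertices X⊑ts = mk⇔ to from
    where
    IH′ : B (node (x ++ X)) ⇔ FaceConditions A ts x X
    IH′ = IH x X x-vertices (⊑⇒⊆ X⊑ts)
    to : subdiv t B (node (x ++ X)) → FaceConditions A (t ∷ ts) x X
    to (inj₁ (_ , _ , _ , x++X≈t∷y)) =
      ⊥-elim (head-∉ x X x-vertices X⊑ts (∈-⊑ (inj₁ ≈-refl) (≈⇒⊑ (≈-sym x++X≈t∷y))))
    to (inj₂ (t⊈x++X , B[x++X])) = conditions-∷ x X t⋢x X⊑ts (Equivalence.to IH′ B[x++X])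
      where
      t⋢x : ¬ t ⊑ node x
      t⋢x t⊑x = t⊈x++X (⊑⇒⊆ (⊑-trans t⊑x (⊑-∪ˡ (node x) (node X))))
    from : FaceConditions A (t ∷ ts) x X → subdiv t B (node (x ++ X))
    from conditions@(avoids , _) =
      inj₂ (head-⋢ x X avoids X⊑ts ∘ ⊆⇒⊑ , Equivalence.from IH′ (conditions-tail x X conditions))

  step : FaceCharacterisation A ts → FaceCharacterisation A (t ∷ ts)
  step IH x X x-vertices X⊆t∷ts with split X (⊆⇒⊑ X⊆t∷ts)
  ... | tail-only X⊑ts            = faces-tail-only IH x X x-vertices X⊑ts
  ... | with-head X′ X′⊑ts X≈t∷X′ = WithHead.faces-with-head x X X′ X′⊑ts X≈t∷X′ IH x-vertices

applyT-faces : {A : Fam U} → IsComplex A → (ts : List (HF U)) → AdditiveListing A ts →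
               FaceCharacterisation A ts
applyT-faces C []       _ x []      _ _    =
  mk⇔ (λ face → (λ _ ()) , face , (λ _ _ ()) , λ _ _ ()) (proj₁ ∘ proj₂)
applyT-faces C []       _ x (s ∷ _) _ X⊆[] = ⊥-elim (X⊆[] s (inj₁ ≈-refl))
applyT-faces C (t ∷ ts) T = Step.step C T (applyT-faces C ts (Step.listing-tail C T))

lemmaB2 : {U : Set} (A : Fam U) → IsDivided A →
          (ts : List (HF U)) → (∀ t → t ∈ₗ ts → A t) → Additive A ts → AdmissibleListing ts →
          (x X : List (HF U)) → (∀ v → v ∈ₗ x → Vr A v) → (∀ s → s ∈ₗ X → s ∈ₗ ts) →
          (applyT ts A (node (x ++ X))
            ⇔ ((∀ t → t ∈ₗ ts → ¬ (t ⊆ node x))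
               × A (node x ∪ ⋃ X)
               × (∀ s s′ → s ∈ₗ X → s′ ∈ₗ X → (s ⊆ s′) ⊎ (s′ ⊆ s))
               × (∀ s t → s ∈ₗ X → t ∈ₗ ts → t ⊆ (node x ∪ s) → t ⊆ s)))
lemmaB2 A (complex , _) ts T⊆A additive admissible =
  applyT-faces complex ts (record { faces = T⊆A ; additive = additive ; admissible = admissible })
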